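{- Let $s\ge 2$ and $t$ be integers, let $g=\frac{s-1}{\gcd(s-1,t)}$ with prime factorization $g=p_1^{j_1}\cdots p_n^{j_n}$ (distinct primes $p_i$, $j_i\ge1$). Let $r=p_1^{e_1}\cdots p_n^{e_n}k\ge 2$ where $e_i\ge 0$ are integers and $k$ is a positive integer with $\gcd(gs,k)=1$. Then $r$ is distinguished with respect to $(s,t)$ if and only if for each $i=1,\dots,n$ at least one of the following holds: (1) $\operatorname{ord}_{p_i^{j_i+e_i}}(s)=\operatorname{ord}_{p_i^{e_i}}(s)$; (2) $\operatorname{ord}_{p_i^{j_i+e_i}}(s)$ divides $\operatorname{ord}_k(s)$.
   Context: For integers $s$ and $r\ge 1$ with $\gcd(r,s)=1$, $\operatorname{ord}_r(s)$ denotes the least positive integer $m$ with $s^m\equiv 1\pmod r$ (so $\operatorname{ord}_1(s)=1$). For integers $s\ge 2$ and $t$, an integer $r\ge 2$ is distinguished with respect to $(s,t)$ if $\gcd(r,s)=1$ and $r$ divides $t\cdot\frac{s^{\operatorname{ord}_r(s)}-1}{s-1}$. -}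

module Defs where

open import Data.Nat using (ℕ; zero; suc; _+_; _*_; _∸_; _^_; _≤_; NonZero)
open import Data.Nat.Divisibility using (_∣?_)
open import Data.Nat.DivMod using (_/_)
open import Data.Nat.Coprimality using (Coprime)
open import Data.Integer as ℤ using (ℤ; +_; ∣_∣)
open import Data.Integer.Divisibility as ℤD using ()
open import Data.Fin using (Fin; zero; suc)
open import Data.Product using (_×_)
open import Relation.Nullary using (yes; no)

prodFin : (n : ℕ) → (Fin n → ℕ) → ℕ
prodFin zero    f = 1
prodFin (suc n) f = f zero * prodFin n (λ i → f (suc i))

-- Bounded search: first m in [m₀, m₀ + fuel) with r ∣ |s^m - 1|, i.e.
-- s^m ≡ 1 (mod r); returns 0 if none is found.
ordSearch : (r s : ℕ) → (fuel m : ℕ) → ℕ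
ordSearch r s zero       m = 0
ordSearch r s (suc fuel) m with r ∣? ∣ (+ (s ^ m)) ℤ.- (+ 1) ∣
... | yes _ = m
... | no  _ = ordSearch r s fuel (suc m)

-- ord r s : the multiplicative order of s modulo r (least m ≥ 1 with
-- s^m ≡ 1 mod r).  For r ≥ 1 with gcd(r,s)=1 this order exists and is ≤ r,
-- so searching m = 1, …, r finds it.  (ord 1 s = 1.)
ord : (r s : ℕ) → ℕ
ord r s = ordSearch r s r 1

Distinguished : (s : ℕ) → .{{NonZero (s ∸ 1)}} → (t : ℤ) → (r : ℕ) → Set
Distinguished s t r =
  (2 ≤ r) × Coprime r s ×
  ((+ r) ℤD.∣ (t ℤ.* (+ (((s ^ ord r s) ∸ 1) / (s ∸ 1)))))

{-# OPTIONS --safe #-}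
module Submission where

-- Multiplying by g = (s − 1)/gcd(s − 1, t) turns "r ∣ t (s^m − 1)/(s − 1)", m = ord_r s, into
-- "r g ∣ t′ (s^m − 1)" with t′ = t/gcd(s − 1, t) prime to g.  As r g = ∏ p_i^(j_i+e_i) · k and
-- k ∣ r ∣ s^m − 1, this says ord(p_i^(j_i+e_i)) ∣ m for every i.  Since p_i ∣ s − 1, that order
-- is a power of p_i, while m is the least common multiple of the orders of the p_l^(e_l) and of k.
-- A prime power divides this lcm only if it divides one of its terms, and among the orders of the
-- p_l^(e_l) only ord(p_i^(e_i)), itself a divisor of ord(p_i^(j_i+e_i)), can carry the prime p_i.

open import Defs
open import Data.Nat
open import Data.Nat.Properties
open import Data.Nat.Divisibility
open import Data.Nat.DivMod
open import Data.Nat.GCD using (gcd; gcd[m,n]∣n; gcd[m,n]≢0)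
open import Data.Nat.Coprimality as Coprime using (Coprime; coprime-divisor; coprime-/gcd; 1-coprimeTo)
open import Data.Nat.Primality
  using (Prime; euclidsLemma; prime⇒irreducible; prime⇒nonZero; prime⇒nonTrivial; ¬prime[1])
open import Data.Nat.Tactic.RingSolver using (solve-∀)
open import Data.Integer as ℤ using (ℤ; +_; ∣_∣)
import Data.Integer.Properties as ℤ
open import Data.Fin as Fin using (Fin; toℕ; fromℕ<)
import Data.Fin.Properties as Fin
open import Data.Product using (_×_; _,_; proj₁; proj₂; ∃-syntax; uncurry)
open import Data.Product.Function.NonDependent.Propositional using (_×-cong_)
open import Data.Sum using (_⊎_; inj₁; inj₂; [_,_]′; map₁)
open import Data.Empty using (⊥-elim)
open import Function.Base using (_∘_)
open import Function.Bundles using (_⇔_; mk⇔; Equivalence)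
open import Function.Definitions using (Injective)
import Function.Related.Propositional as Related
open import Relation.Nullary using (¬_; yes; no)
open import Relation.Binary.PropositionalEquality
  using (_≡_; _≢_; refl; sym; trans; cong; cong₂; subst; subst₂; module ≡-Reasoning)

open Equivalence using (to; from)
open Related using (reverse)

∀-cong : ∀ {n} {A B : Fin n → Set} → (∀ i → A i ⇔ B i) → (∀ i → A i) ⇔ (∀ i → B i)
∀-cong A⇔B = mk⇔ (λ a i → to (A⇔B i) (a i)) (λ b i → from (A⇔B i) (b i))

coprime-* : ∀ {a b c} → Coprime a c → Coprime b c → Coprime (a * b) c
coprime-* {a} a⊥c b⊥c {d} (d∣ab , d∣c) = b⊥c (coprime-divisor d⊥a d∣ab , d∣c)
  where
  d⊥a : Coprime d a
  d⊥a (e∣d , e∣a) = a⊥c (e∣a , ∣-trans e∣d d∣c)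

coprime-^ˡ : ∀ {a c} → Coprime a c → ∀ n → Coprime (a ^ n) c
coprime-^ˡ a⊥c zero    = 1-coprimeTo _
coprime-^ˡ a⊥c (suc n) = coprime-* a⊥c (coprime-^ˡ a⊥c n)

coprime-^ʳ : ∀ {a c} → Coprime a c → ∀ n → Coprime a (c ^ n)
coprime-^ʳ a⊥c n = Coprime.sym (coprime-^ˡ (Coprime.sym a⊥c) n)

∣∧coprime⇒coprime : ∀ {d a c} → d ∣ a → Coprime a c → Coprime d c
∣∧coprime⇒coprime d∣a a⊥c (e∣d , e∣c) = a⊥c (∣-trans e∣d d∣a , e∣c)

coprime⇒*∣⇔ : ∀ {a b x} → Coprime a b → (a * b ∣ x) ⇔ ((a ∣ x) × (b ∣ x))
coprime⇒*∣⇔ {a} {b} a⊥b = mk⇔ (λ ab∣x → m*n∣⇒m∣ a b ab∣x , m*n∣⇒n∣ a b ab∣x) (uncurry *∣)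
  where
  *∣ : ∀ {x} → a ∣ x → b ∣ x → a * b ∣ x
  *∣ (divides q refl) b∣qa = subst (a * b ∣_) (*-comm a q)
    (*-monoʳ-∣ a (coprime-divisor (Coprime.sym a⊥b) (subst (b ∣_) (*-comm q a) b∣qa)))

coprime⇒*∣*⇔ : ∀ {a b x y} → Coprime a x → Coprime a b → b ∣ y → (a * b ∣ x * y) ⇔ (a ∣ y)
coprime⇒*∣*⇔ {a} {b} {x} a⊥x a⊥b b∣y = mk⇔
  (λ ab∣xy → coprime-divisor a⊥x (m*n∣⇒m∣ a b ab∣xy))
  (λ a∣y → from (coprime⇒*∣⇔ a⊥b) (∣n⇒∣m*n x a∣y , ∣n⇒∣m*n x b∣y))

m∣m^n : ∀ {m n} → 1 ≤ n → m ∣ m ^ n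
m∣m^n {n = suc n} _ = m∣m*n _

m%n≡[m+o]%n⇒n∣o : ∀ m o n .{{_ : NonZero n}} → m % n ≡ (m + o) % n → n ∣ o
m%n≡[m+o]%n⇒n∣o m o n m%n≡[m+o]%n = ∣m+n∣m⇒∣n n∣[m/n]n+o (n∣m*n (m / n))
  where
  open ≡-Reasoning
  n∣[m/n]n+o : n ∣ m / n * n + o
  n∣[m/n]n+o = subst (n ∣_) (+-cancelˡ-≡ (m % n) _ _ (begin
    m % n + (m + o) / n * n         ≡⟨ cong (_+ (m + o) / n * n) m%n≡[m+o]%n ⟩
    (m + o) % n + (m + o) / n * n   ≡⟨ m≡m%n+[m/n]*n (m + o) n ⟨
    m + o                           ≡⟨ cong (_+ o) (m≡m%n+[m/n]*n m n) ⟩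
    m % n + m / n * n + o           ≡⟨ +-assoc (m % n) _ o ⟩
    m % n + (m / n * n + o)         ∎)) (n∣m*n ((m + o) / n))

prime∤⇒coprime : ∀ {p n} → Prime p → ¬ p ∣ n → Coprime p n
prime∤⇒coprime p-prime p∤n d∣p×d∣n with prime⇒irreducible p-prime (proj₁ d∣p×d∣n)
... | inj₁ d≡1  = d≡1
... | inj₂ refl = ⊥-elim (p∤n (proj₂ d∣p×d∣n))

prime∣prime⇒≡ : ∀ {p q} → Prime p → Prime q → p ∣ q → p ≡ q
prime∣prime⇒≡ p-prime q-prime p∣q with prime⇒irreducible q-prime p∣q
... | inj₁ refl = ⊥-elim (¬prime[1] p-prime)
... | inj₂ p≡q  = p≡q

prime∣prime^⇒≡ : ∀ {p q} → Prime p → Prime q → ∀ e → p ∣ q ^ e → p ≡ q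
prime∣prime^⇒≡ p-prime q-prime zero    p∣1 rewrite ∣1⇒≡1 p∣1 = ⊥-elim (¬prime[1] p-prime)
prime∣prime^⇒≡ p-prime q-prime (suc e) p∣qqᵉ with euclidsLemma _ _ p-prime p∣qqᵉ
... | inj₁ p∣q  = prime∣prime⇒≡ p-prime q-prime p∣q
... | inj₂ p∣qᵉ = prime∣prime^⇒≡ p-prime q-prime e p∣qᵉ

∣p^c∧≢1⇒p∣ : ∀ {p d} c → Prime p → d ∣ p ^ c → d ≢ 1 → p ∣ d
∣p^c∧≢1⇒p∣ {p} {d} c p-prime d∣pᶜ d≢1 with p ∣? d
... | yes p∣d = p∣d
... | no  p∤d = ⊥-elim (d≢1 (coprime-^ʳ (Coprime.sym (prime∤⇒coprime p-prime p∤d)) c (∣-refl , d∣pᶜ)))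

-- Write y z = p x: if p ∣ z we may cancel p; otherwise z is prime to O, and O ∣ y z forces O ∣ y.
∣p*x⇒∣x : ∀ {p O x y} c → Prime p → O ∣ p ^ c → O ∣ p * x → ¬ O ∣ y → y ∣ p * x → y ∣ x
∣p*x⇒∣x {p} {O} {x} {y} c p-prime O∣pᶜ O∣px O∤y (divides z px≡zy) with p ∣? z
... | yes (divides w refl) = divides w (*-cancelˡ-≡ x (w * y) p {{prime⇒nonZero p-prime}}
        (trans px≡zy (trans (cong (_* y) (*-comm w p)) (*-assoc p w y))))
... | no p∤z = ⊥-elim (O∤y (coprime-divisor O⊥z (subst (O ∣_) px≡zy O∣px)))
  where
  O⊥z : Coprime O z
  O⊥z = ∣∧coprime⇒coprime O∣pᶜ (coprime-^ˡ (prime∤⇒coprime p-prime p∤z) c)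

PairwiseCoprime : ∀ n → (Fin n → ℕ) → Set
PairwiseCoprime n f = ∀ i l → i ≢ l → Coprime (f i) (f l)

primePowers-pairwiseCoprime : ∀ {n} {p : Fin n → ℕ} → (∀ i → Prime (p i)) → Injective _≡_ _≡_ p →
                              (a : Fin n → ℕ) → PairwiseCoprime n (λ i → p i ^ a i)
primePowers-pairwiseCoprime prime p-injective a i l i≢l = coprime-^ʳ (coprime-^ˡ pᵢ⊥pₗ (a i)) (a l)
  where
  pᵢ⊥pₗ = prime∤⇒coprime (prime i) (i≢l ∘ p-injective ∘ prime∣prime⇒≡ (prime i) (prime l))

∣prodFin : ∀ n (f : Fin n → ℕ) i → f i ∣ prodFin n f
∣prodFin (suc n) f Fin.zero    = m∣m*n _
∣prodFin (suc n) f (Fin.suc i) = ∣n⇒∣m*n (f Fin.zero) (∣prodFin n (f ∘ Fin.suc) i)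

prodFin-pos : ∀ n (f : Fin n → ℕ) → (∀ i → 1 ≤ f i) → 1 ≤ prodFin n f
prodFin-pos zero    f f≥1 = ≤-refl
prodFin-pos (suc n) f f≥1 = *-mono-≤ (f≥1 Fin.zero) (prodFin-pos n (f ∘ Fin.suc) (f≥1 ∘ Fin.suc))

prodFin-coprime : ∀ n (f : Fin n → ℕ) {c} → (∀ i → Coprime (f i) c) → Coprime (prodFin n f) c
prodFin-coprime zero    f f⊥c = 1-coprimeTo _
prodFin-coprime (suc n) f f⊥c =
  coprime-* (f⊥c Fin.zero) (prodFin-coprime n (f ∘ Fin.suc) (f⊥c ∘ Fin.suc))

pairwiseCoprime⇒prodFin∣⇔ : ∀ n (f : Fin n → ℕ) {x} → PairwiseCoprime n f →
                             (prodFin n f ∣ x) ⇔ (∀ i → f i ∣ x)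
pairwiseCoprime⇒prodFin∣⇔ n f f-coprime =
  mk⇔ (λ Πf∣x i → ∣-trans (∣prodFin n f i) Πf∣x) (prodFin∣ n f f-coprime)
  where
  prodFin∣ : ∀ n (f : Fin n → ℕ) {x} → PairwiseCoprime n f → (∀ i → f i ∣ x) → prodFin n f ∣ x
  prodFin∣ zero    f _         _   = 1∣ _
  prodFin∣ (suc n) f f-coprime f∣x = from (coprime⇒*∣⇔ f₀⊥Πf)
    (f∣x Fin.zero , prodFin∣ n (f ∘ Fin.suc) (λ i l → f-coprime _ _ ∘ (_∘ Fin.suc-injective)) (f∣x ∘ Fin.suc))
    where
    f₀⊥Πf = Coprime.sym (prodFin-coprime n (f ∘ Fin.suc) (λ i → f-coprime _ _ λ ()))

prodFin-* : ∀ n (f h : Fin n → ℕ) → prodFin n f * prodFin n h ≡ prodFin n (λ i → f i * h i)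
prodFin-* zero    f h = refl
prodFin-* (suc n) f h = trans ([m*n]*[o*p]≡[m*o]*[n*p] (f Fin.zero) _ (h Fin.zero) _)
  (cong (f Fin.zero * h Fin.zero *_) (prodFin-* n (f ∘ Fin.suc) (h ∘ Fin.suc)))

prodFin-cong : ∀ n {f h : Fin n → ℕ} → (∀ i → f i ≡ h i) → prodFin n f ≡ prodFin n h
prodFin-cong zero    f≡h = refl
prodFin-cong (suc n) f≡h = cong₂ _*_ (f≡h Fin.zero) (prodFin-cong n (f≡h ∘ Fin.suc))

prodFin-^-+ : ∀ n (p a b : Fin n → ℕ) →
              prodFin n (λ i → p i ^ (a i + b i)) ≡ prodFin n (λ i → p i ^ a i) * prodFin n (λ i → p i ^ b i)
prodFin-^-+ n p a b = trans (prodFin-cong n (λ i → ^-distribˡ-+-* (p i) (a i) (b i))) (sym (prodFin-* n _ _))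

record LeastFrom (P : ℕ → Set) (m₀ o : ℕ) : Set where
  field
    lower : m₀ ≤ o
    holds : P o
    least : ∀ {m} → m₀ ≤ m → m < o → ¬ P m

ordSearch-leastFrom : ∀ a s fuel m₀ {w} → m₀ ≤ w → w < m₀ + fuel → a ∣ ∣ + (s ^ w) ℤ.- + 1 ∣ →
                      LeastFrom (λ m → a ∣ ∣ + (s ^ m) ℤ.- + 1 ∣) m₀ (ordSearch a s fuel m₀)
ordSearch-leastFrom a s zero m₀ m₀≤w w<m₀+0 _ =
  ⊥-elim (<⇒≱ (subst (_ <_) (+-identityʳ m₀) w<m₀+0) m₀≤w)
ordSearch-leastFrom a s (suc fuel) m₀ {w} m₀≤w w<m₀+1+fuel Pw with a ∣? ∣ + (s ^ m₀) ℤ.- + 1 ∣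
... | yes Pm₀ = record { lower = ≤-refl ; holds = Pm₀ ; least = λ m₀≤m m<m₀ → ⊥-elim (<⇒≱ m<m₀ m₀≤m) }
... | no ¬Pm₀ = record { lower = ≤-trans (n≤1+n m₀) lower ; holds = holds ; least = least′ }
  where
  m₀<w : m₀ < w
  m₀<w = ≤∧≢⇒< m₀≤w λ { refl → ¬Pm₀ Pw }
  open LeastFrom (ordSearch-leastFrom a s fuel (suc m₀) m₀<w (subst (w <_) (+-suc m₀ fuel) w<m₀+1+fuel) Pw)
  least′ : ∀ {m} → m₀ ≤ m → m < ordSearch a s fuel (suc m₀) → ¬ a ∣ ∣ + (s ^ m) ℤ.- + 1 ∣
  least′ m₀≤m m<o with m≤n⇒m<n∨m≡n m₀≤m
  ... | inj₁ m₀<m = least m₀<m m<o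
  ... | inj₂ refl = ¬Pm₀

module Order (s : ℕ) .{{_ : NonZero s}} where

  s^m≡1+[s^m∸1] : ∀ m → s ^ m ≡ suc (s ^ m ∸ 1)
  s^m≡1+[s^m∸1] m = sym (m+[n∸m]≡n (m^n>0 s m))

  s^[m+n]∸1≡s^m∸1+s^m*[s^n∸1] : ∀ m n → s ^ (m + n) ∸ 1 ≡ (s ^ m ∸ 1) + s ^ m * (s ^ n ∸ 1)
  s^[m+n]∸1≡s^m∸1+s^m*[s^n∸1] m n = suc-injective (begin
    suc (s ^ (m + n) ∸ 1)                  ≡⟨ s^m≡1+[s^m∸1] (m + n) ⟨
    s ^ (m + n)                            ≡⟨ ^-distribˡ-+-* s m n ⟩
    s ^ m * s ^ n                          ≡⟨ cong (s ^ m *_) (s^m≡1+[s^m∸1] n) ⟩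
    s ^ m * suc (s ^ n ∸ 1)                ≡⟨ *-suc (s ^ m) _ ⟩
    s ^ m + s ^ m * (s ^ n ∸ 1)            ≡⟨ cong (_+ s ^ m * (s ^ n ∸ 1)) (s^m≡1+[s^m∸1] m) ⟩
    suc (s ^ m ∸ 1) + s ^ m * (s ^ n ∸ 1)  ∎)
    where open ≡-Reasoning

  ∣s^∸1-+ : ∀ {a} m n → a ∣ s ^ m ∸ 1 → a ∣ s ^ n ∸ 1 → a ∣ s ^ (m + n) ∸ 1
  ∣s^∸1-+ {a} m n a∣ᵐ a∣ⁿ = subst (a ∣_) (sym (s^[m+n]∸1≡s^m∸1+s^m*[s^n∸1] m n))
    (∣m∣n⇒∣m+n a∣ᵐ (∣n⇒∣m*n (s ^ m) a∣ⁿ))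

  ∣s^∸1-* : ∀ {a} q m → a ∣ s ^ m ∸ 1 → a ∣ s ^ (q * m) ∸ 1
  ∣s^∸1-* zero    m a∣ᵐ = _ ∣0
  ∣s^∸1-* (suc q) m a∣ᵐ = ∣s^∸1-+ m (q * m) a∣ᵐ (∣s^∸1-* q m a∣ᵐ)

  ∣s^∸1-cancel : ∀ {a} m n → Coprime a s → a ∣ s ^ (m + n) ∸ 1 → a ∣ s ^ m ∸ 1 → a ∣ s ^ n ∸ 1
  ∣s^∸1-cancel {a} m n a⊥s a∣ᵐ⁺ⁿ a∣ᵐ = coprime-divisor (coprime-^ʳ a⊥s m)
    (∣m+n∣m⇒∣n (subst (a ∣_) (s^[m+n]∸1≡s^m∸1+s^m*[s^n∸1] m n) a∣ᵐ⁺ⁿ) a∣ᵐ)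

  s∸1∣s^m∸1 : ∀ m → s ∸ 1 ∣ s ^ m ∸ 1
  s∸1∣s^m∸1 zero    = _ ∣0
  s∸1∣s^m∸1 (suc m) = ∣s^∸1-+ 1 m (∣-reflexive (cong (_∸ 1) (sym (*-identityʳ s)))) (s∸1∣s^m∸1 m)

  ∣s∸1⇒coprime : ∀ {x} → x ∣ s ∸ 1 → Coprime x s
  ∣s∸1⇒coprime x∣s∸1 (d∣x , d∣s) = ∣1⇒≡1 (∣m+n∣m⇒∣n
    (subst (_ ∣_) (sym (trans (+-comm (s ∸ 1) 1) (suc-pred s))) d∣s) (∣-trans d∣x x∣s∸1))

  ∣+s^m-1∣≡s^m∸1 : ∀ m → ∣ + (s ^ m) ℤ.- + 1 ∣ ≡ s ^ m ∸ 1
  ∣+s^m-1∣≡s^m∸1 m = cong ∣_∣ (ℤ.⊖-≥ (m^n>0 s m))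

  period-exists : ∀ {a} → 1 ≤ a → Coprime a s → ∃[ w ] 1 ≤ w × w ≤ a × a ∣ s ^ w ∸ 1
  period-exists {a@(suc _)} _ a⊥s with Fin.pigeonhole (n<1+n a) (λ i → fromℕ< (m%n<n (s ^ toℕ i) a))
  ... | i , j , i<j , same =
    d , m<n⇒0<n∸m i<j , ≤-trans (m∸n≤m (toℕ j) (toℕ i)) (s≤s⁻¹ (Fin.toℕ<n j)) , a∣s^d∸1
    where
    d = toℕ j ∸ toℕ i
    sʲ≡sⁱ+sⁱ[s^d∸1] : s ^ toℕ j ≡ s ^ toℕ i + s ^ toℕ i * (s ^ d ∸ 1)
    sʲ≡sⁱ+sⁱ[s^d∸1] = begin
      s ^ toℕ j                            ≡⟨ cong (s ^_) (m+[n∸m]≡n (<⇒≤ i<j)) ⟨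
      s ^ (toℕ i + d)                      ≡⟨ ^-distribˡ-+-* s (toℕ i) d ⟩
      s ^ toℕ i * s ^ d                    ≡⟨ cong (s ^ toℕ i *_) (s^m≡1+[s^m∸1] d) ⟩
      s ^ toℕ i * suc (s ^ d ∸ 1)          ≡⟨ *-suc (s ^ toℕ i) _ ⟩
      s ^ toℕ i + s ^ toℕ i * (s ^ d ∸ 1)  ∎
      where open ≡-Reasoning
    sⁱ≡sʲ-mod-a : s ^ toℕ i % a ≡ s ^ toℕ j % a
    sⁱ≡sʲ-mod-a = trans (sym (Fin.toℕ-fromℕ< _)) (trans (cong toℕ same) (Fin.toℕ-fromℕ< _))
    a∣s^d∸1 : a ∣ s ^ d ∸ 1
    a∣s^d∸1 = coprime-divisor (coprime-^ʳ a⊥s (toℕ i))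
      (m%n≡[m+o]%n⇒n∣o (s ^ toℕ i) _ a (trans sⁱ≡sʲ-mod-a (cong (_% a) sʲ≡sⁱ+sⁱ[s^d∸1])))

  ord-leastFrom : ∀ {a} → 1 ≤ a → Coprime a s → LeastFrom (λ m → a ∣ s ^ m ∸ 1) 1 (ord a s)
  ord-leastFrom {a} a≥1 a⊥s with period-exists a≥1 a⊥s
  ... | w , w≥1 , w≤a , a∣s^w∸1 = record
    { lower = lower
    ; holds = subst (a ∣_) (∣+s^m-1∣≡s^m∸1 (ord a s)) holds
    ; least = λ {m} 1≤m m<o a∣ → least 1≤m m<o (subst (a ∣_) (sym (∣+s^m-1∣≡s^m∸1 m)) a∣)
    }
    where
    open LeastFrom (ordSearch-leastFrom a s a 1 w≥1 (s≤s w≤a)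
                     (subst (a ∣_) (sym (∣+s^m-1∣≡s^m∸1 w)) a∣s^w∸1))

  module _ {a} (a≥1 : 1 ≤ a) (a⊥s : Coprime a s) where
    open LeastFrom (ord-leastFrom a≥1 a⊥s)

    ord≥1 : 1 ≤ ord a s
    ord≥1 = lower

    ∣s^ord∸1 : a ∣ s ^ ord a s ∸ 1
    ∣s^ord∸1 = holds

    ord∣⇔∣s^∸1 : ∀ m → (ord a s ∣ m) ⇔ (a ∣ s ^ m ∸ 1)
    ord∣⇔∣s^∸1 m = mk⇔ (λ { (divides q refl) → ∣s^∸1-* q (ord a s) holds }) ord∣
      where
      o = ord a s
      instance _ = >-nonZero lower
      a∣s^[m%o]∸1 : a ∣ s ^ m ∸ 1 → a ∣ s ^ (m % o) ∸ 1
      a∣s^[m%o]∸1 a∣ = ∣s^∸1-cancel (m / o * o) (m % o) a⊥s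
        (subst (λ x → a ∣ s ^ x ∸ 1) (trans (m≡m%n+[m/n]*n m o) (+-comm (m % o) _)) a∣)
        (∣s^∸1-* (m / o) o holds)
      ord∣ : a ∣ s ^ m ∸ 1 → o ∣ m
      ord∣ a∣ = m%n≡0⇒n∣m m o (m%o≡0 (m % o) refl (a∣s^[m%o]∸1 a∣))
        where
        m%o≡0 : ∀ r → r ≡ m % o → a ∣ s ^ r ∸ 1 → r ≡ 0
        m%o≡0 zero    _      _  = refl
        m%o≡0 (suc r) r≡m%o a∣ = ⊥-elim (least (s≤s z≤n) (subst (_< o) (sym r≡m%o) (m%n<n m o)) a∣)

  ∣⇒ord∣ord : ∀ {a b} → 1 ≤ b → Coprime b s → a ∣ b → ord a s ∣ ord b s
  ∣⇒ord∣ord {a} {b} b≥1 b⊥s a∣b =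
    from (ord∣⇔∣s^∸1 a≥1 (∣∧coprime⇒coprime a∣b b⊥s) (ord b s)) (∣-trans a∣b (∣s^ord∸1 b≥1 b⊥s))
    where
    a≥1 : 1 ≤ a
    a≥1 = n≢0⇒n>0 λ { refl → ≢-nonZero⁻¹ _ {{>-nonZero b≥1}} (0∣⇒≡0 a∣b) }

  prodFin∣s^∸1⇔ : ∀ n (f : Fin n → ℕ) → PairwiseCoprime n f → (∀ i → 1 ≤ f i) → (∀ i → Coprime (f i) s) →
                  ∀ m → (prodFin n f ∣ s ^ m ∸ 1) ⇔ (∀ i → ord (f i) s ∣ m)
  prodFin∣s^∸1⇔ n f f-coprime f≥1 f⊥s m = begin
    (prodFin n f ∣ s ^ m ∸ 1)   ∼⟨ pairwiseCoprime⇒prodFin∣⇔ n f f-coprime ⟩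
    (∀ i → f i ∣ s ^ m ∸ 1)     ∼⟨ ∀-cong (λ i → reverse (ord∣⇔∣s^∸1 (f≥1 i) (f⊥s i) m)) ⟩
    (∀ i → ord (f i) s ∣ m)     ∎
    where open Related.EquationalReasoning {k = Related.equivalence}

  s^[n*u]∸1-expansion : ∀ u n → ∃[ H ] s ^ (n * u) ∸ 1 ≡ (s ^ u ∸ 1) * (n + (s ^ u ∸ 1) * H)
  s^[n*u]∸1-expansion u zero    = 0 , sym (trans (cong (Y *_) (*-zeroʳ Y)) (*-zeroʳ Y))
    where Y = s ^ u ∸ 1
  s^[n*u]∸1-expansion u (suc n) with s^[n*u]∸1-expansion u n
  ... | H , eq = n + Y * H + H , (begin
    s ^ (u + n * u) ∸ 1                ≡⟨ s^[m+n]∸1≡s^m∸1+s^m*[s^n∸1] u (n * u) ⟩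
    Y + s ^ u * (s ^ (n * u) ∸ 1)      ≡⟨ cong₂ (λ a b → Y + a * b) (s^m≡1+[s^m∸1] u) eq ⟩
    Y + suc Y * (Y * (n + Y * H))      ≡⟨ expand Y n H ⟩
    Y * (suc n + Y * (n + Y * H + H))  ∎)
    where
    open ≡-Reasoning
    Y = s ^ u ∸ 1
    expand : ∀ Y n H → Y + suc Y * (Y * (n + Y * H)) ≡ Y * (suc n + Y * (n + Y * H + H))
    expand = solve-∀

  ∣s^∸1-lift : ∀ {p A u} → p ∣ A → A ∣ s ^ u ∸ 1 → A * p ∣ s ^ (p * u) ∸ 1
  ∣s^∸1-lift {p} {A} {u} p∣A A∣Y with s^[n*u]∸1-expansion u p
  ... | H , eq = subst (A * p ∣_) (sym eq)
    (*-pres-∣ A∣Y (∣m∣n⇒∣m+n ∣-refl (∣m⇒∣m*n H (∣-trans p∣A A∣Y))))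

  p^[1+c]∣s^[p^c]∸1 : ∀ {p} → p ∣ s ∸ 1 → ∀ c → p ^ suc c ∣ s ^ (p ^ c) ∸ 1
  p^[1+c]∣s^[p^c]∸1 {p} p∣s∸1 zero    =
    subst₂ _∣_ (sym (*-identityʳ p)) (cong (_∸ 1) (sym (*-identityʳ s))) p∣s∸1
  p^[1+c]∣s^[p^c]∸1 {p} p∣s∸1 (suc c) = subst (_∣ s ^ (p ^ suc c) ∸ 1) (*-comm (p ^ suc c) p)
    (∣s^∸1-lift {p} {u = p ^ c} (m∣m*n (p ^ c)) (p^[1+c]∣s^[p^c]∸1 p∣s∸1 c))

  ord[p^c]∣p^c : ∀ {p} .{{_ : NonZero p}} → p ∣ s ∸ 1 → ∀ c → ord (p ^ c) s ∣ p ^ c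
  ord[p^c]∣p^c {p} p∣s∸1 c = from (ord∣⇔∣s^∸1 (m^n>0 p c) (coprime-^ˡ (∣s∸1⇒coprime p∣s∸1) c) (p ^ c))
    (∣-trans (n∣m*n p) (p^[1+c]∣s^[p^c]∸1 p∣s∸1 c))

module Components (s : ℕ) .{{_ : NonZero s}} {n} {p : Fin n → ℕ} (e : Fin n → ℕ) (k : ℕ)
  (prime : ∀ i → Prime (p i)) (p-injective : Injective _≡_ _≡_ p) (p∣s∸1 : ∀ i → p i ∣ s ∸ 1)
  (k≥1 : 1 ≤ k) (k⊥s : Coprime k s) (p⊥k : ∀ i → Coprime (p i) k) where
  open Order s

  instance
    p≢0 : ∀ {i} → NonZero (p i)
    p≢0 {i} = prime⇒nonZero (prime i)

  p^c≥1 : ∀ i c → 1 ≤ p i ^ c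
  p^c≥1 i c = m^n>0 (p i) c

  p^c⊥s : ∀ i c → Coprime (p i ^ c) s
  p^c⊥s i c = coprime-^ˡ (∣s∸1⇒coprime (p∣s∸1 i)) c

  Πp^c⊥ : ∀ {x} → (∀ i → Coprime (p i) x) → (c : Fin n → ℕ) → Coprime (prodFin n (λ i → p i ^ c i)) x
  Πp^c⊥ p⊥x c = prodFin-coprime n _ (λ i → coprime-^ˡ (p⊥x i) (c i))

  Πp^c∣s^∸1⇔ : (c : Fin n → ℕ) → ∀ m →
               (prodFin n (λ i → p i ^ c i) ∣ s ^ m ∸ 1) ⇔ (∀ i → ord (p i ^ c i) s ∣ m)
  Πp^c∣s^∸1⇔ c = prodFin∣s^∸1⇔ n _ (primePowers-pairwiseCoprime prime p-injective c)
    (λ i → p^c≥1 i (c i)) (λ i → p^c⊥s i (c i))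

  pᵉ : Fin n → ℕ
  pᵉ i = p i ^ e i

  r : ℕ
  r = prodFin n pᵉ * k

  r≥1 : 1 ≤ r
  r≥1 = *-mono-≤ (prodFin-pos n pᵉ (λ i → p^c≥1 i (e i))) k≥1

  r⊥s : Coprime r s
  r⊥s = coprime-* (prodFin-coprime n pᵉ (λ i → p^c⊥s i (e i))) k⊥s

  ord-r∣⇔ : ∀ x → (ord r s ∣ x) ⇔ ((∀ l → ord (pᵉ l) s ∣ x) × (ord k s ∣ x))
  ord-r∣⇔ x = begin
    (ord r s ∣ x)                                    ∼⟨ ord∣⇔∣s^∸1 r≥1 r⊥s x ⟩
    (r ∣ s ^ x ∸ 1)                                  ∼⟨ coprime⇒*∣⇔ (Πp^c⊥ p⊥k e) ⟩
    ((prodFin n pᵉ ∣ s ^ x ∸ 1) × (k ∣ s ^ x ∸ 1))   ∼⟨ Πp^c∣s^∸1⇔ e x ×-cong reverse (ord∣⇔∣s^∸1 k≥1 k⊥s x) ⟩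
    ((∀ l → ord (pᵉ l) s ∣ x) × (ord k s ∣ x))       ∎
    where open Related.EquationalReasoning {k = Related.equivalence}

  module _ (i : Fin n) (j : ℕ) where
    O : ℕ
    O = ord (p i ^ (j + e i)) s

    private
      instance
        ord-r≢0 : NonZero (ord r s)
        ord-r≢0 = >-nonZero (ord≥1 r≥1 r⊥s)
        pᵢ-nonTrivial : NonTrivial (p i)
        pᵢ-nonTrivial = prime⇒nonTrivial (prime i)

      components∣ord-r : (∀ l → ord (pᵉ l) s ∣ ord r s) × (ord k s ∣ ord r s)
      components∣ord-r = to (ord-r∣⇔ (ord r s)) ∣-refl

    -- If O divides neither, then p i ∣ O ∣ ord r s and every component order already divides
    -- ord r s / p i, contradicting the minimality of ord r s.
    ord[p^[j+e]]∣ord-r⇒∣component : O ∣ ord r s → (O ∣ ord (pᵉ i) s) ⊎ (O ∣ ord k s)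
    ord[p^[j+e]]∣ord-r⇒∣component O∣m with O ∣? ord (pᵉ i) s | O ∣? ord k s
    ... | yes O∣Lᵢ | _       = inj₁ O∣Lᵢ
    ... | no _     | yes O∣K = inj₂ O∣K
    ... | no O∤Lᵢ  | no O∤K  = ⊥-elim (<⇒≱ (quotient-< pᵢ∣m) (∣⇒≤ m∣x))
      where
      m = ord r s
      O∣pᶜ : O ∣ p i ^ (j + e i)
      O∣pᶜ = ord[p^c]∣p^c (p∣s∸1 i) (j + e i)
      pᵢ∣O : p i ∣ O
      pᵢ∣O = ∣p^c∧≢1⇒p∣ (j + e i) (prime i) O∣pᶜ (λ O≡1 → O∤K (subst (_∣ ord k s) (sym O≡1) (1∣ _)))
      pᵢ∣m : p i ∣ m
      pᵢ∣m = ∣-trans pᵢ∣O O∣m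
      x = quotient pᵢ∣m
      instance _ = quotient≢0 pᵢ∣m
      m≡pᵢx : m ≡ p i * x
      m≡pᵢx = m∣n⇒n≡m*quotient pᵢ∣m
      O∤Lₗ : ∀ l → ¬ O ∣ ord (pᵉ l) s
      O∤Lₗ l with l Fin.≟ i
      ... | yes refl = O∤Lᵢ
      ... | no l≢i   = λ O∣Lₗ → l≢i (sym (p-injective (prime∣prime^⇒≡ (prime i) (prime l) (e l)
                         (∣-trans pᵢ∣O (∣-trans O∣Lₗ (ord[p^c]∣p^c (p∣s∸1 l) (e l)))))))
      ∣x : ∀ {y} → ¬ O ∣ y → y ∣ m → y ∣ x
      ∣x O∤y y∣m = ∣p*x⇒∣x (j + e i) (prime i) O∣pᶜ
        (subst (O ∣_) m≡pᵢx O∣m) O∤y (subst (_ ∣_) m≡pᵢx y∣m)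
      m∣x : m ∣ x
      m∣x = from (ord-r∣⇔ x)
        ((λ l → ∣x (O∤Lₗ l) (proj₁ components∣ord-r l)) , ∣x O∤K (proj₂ components∣ord-r))

    ord[p^[j+e]]∣ord-r⇔ : (O ∣ ord r s) ⇔ (O ≡ ord (pᵉ i) s ⊎ (O ∣ ord k s))
    ord[p^[j+e]]∣ord-r⇔ = mk⇔
      (map₁ (λ O∣Lᵢ → ∣-antisym O∣Lᵢ Lᵢ∣O) ∘ ord[p^[j+e]]∣ord-r⇒∣component)
      [ (λ O≡Lᵢ → subst (_∣ ord r s) (sym O≡Lᵢ) (proj₁ components∣ord-r i))
      , (λ O∣K → ∣-trans O∣K (proj₂ components∣ord-r)) ]′
      where
      Lᵢ∣O : ord (pᵉ i) s ∣ O
      Lᵢ∣O = ∣⇒ord∣ord (p^c≥1 i (j + e i)) (p^c⊥s i (j + e i))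
        (subst (pᵉ i ∣_) (sym (^-distribˡ-+-* (p i) j (e i))) (n∣m*n (p i ^ j)))

gcd-cofactors : ∀ {S T g} → g * gcd (suc S) T ≡ suc S → ∃[ t′ ] T ≡ gcd (suc S) T * t′ × Coprime g t′
gcd-cofactors {S} {T} {g} g*d≡S = T / d , sym (m*[n/m]≡n (gcd[m,n]∣n (suc S) T)) , g⊥T/d
  where
  d = gcd (suc S) T
  instance _ = ≢-nonZero (gcd[m,n]≢0 (suc S) T (inj₁ λ ()))
  g⊥T/d : Coprime g (T / d)
  g⊥T/d = subst (λ x → Coprime x (T / d)) (trans (cong (_/ d) (sym g*d≡S)) (m*n/n≡m g d))
                (coprime-/gcd (suc S) T)

distinguished⇔ : ∀ {s₀ t g d t′ r} → g * d ≡ suc s₀ → ∣ t ∣ ≡ d * t′ → 2 ≤ r → Coprime r (suc (suc s₀)) →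
                 Distinguished (suc (suc s₀)) t r ⇔ (r * g ∣ t′ * (suc (suc s₀) ^ ord r (suc (suc s₀)) ∸ 1))
distinguished⇔ {s₀} {t} {g} {d} {t′} {r} g*d≡s∸1 ∣t∣≡dt′ r≥2 r⊥s = mk⇔
  (λ (_ , _ , r∣tQ) → subst (r * g ∣_) ∣t∣Qg≡t′Y (*-monoˡ-∣ g (subst (r ∣_) (ℤ.abs-* t (+ Q)) r∣tQ)))
  distinguished
  where
  s = suc (suc s₀)
  Y = s ^ ord r s ∸ 1
  Q = Y / suc s₀
  g≢0 : NonZero g
  g≢0 = ≢-nonZero λ { refl → 0≢1+n g*d≡s∸1 }
  ∣t∣Qg≡t′Y : ∣ t ∣ * Q * g ≡ t′ * Y
  ∣t∣Qg≡t′Y = begin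
    ∣ t ∣ * Q * g       ≡⟨ cong (λ x → x * Q * g) ∣t∣≡dt′ ⟩
    d * t′ * Q * g      ≡⟨ rearrange d t′ Q g ⟩
    t′ * (Q * (g * d))  ≡⟨ cong (λ x → t′ * (Q * x)) g*d≡s∸1 ⟩
    t′ * (Q * suc s₀)   ≡⟨ cong (t′ *_) (m/n*n≡m (Order.s∸1∣s^m∸1 s (ord r s))) ⟩
    t′ * Y              ∎
    where
    open ≡-Reasoning
    rearrange : ∀ d t′ Q g → d * t′ * Q * g ≡ t′ * (Q * (g * d))
    rearrange = solve-∀
  distinguished : r * g ∣ t′ * Y → Distinguished s t r
  distinguished rg∣t′Y = r≥2 , r⊥s , subst (r ∣_) (sym (ℤ.abs-* t (+ Q)))
    (*-cancelʳ-∣ g {{g≢0}} (subst (r * g ∣_) (sym ∣t∣Qg≡t′Y) rg∣t′Y))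

lemma3p5 : (s₀ : ℕ) (t : ℤ) (g : ℕ) →
    g * gcd (suc (suc s₀) ∸ 1) ∣ t ∣ ≡ suc (suc s₀) ∸ 1 →
    (n : ℕ) (p j : Fin n → ℕ) →
    (∀ i → Prime (p i)) → Injective _≡_ _≡_ p → (∀ i → 1 ≤ j i) →
    g ≡ prodFin n (λ i → p i ^ j i) →
    (e : Fin n → ℕ) (k : ℕ) → 1 ≤ k → Coprime (g * suc (suc s₀)) k →
    (r : ℕ) → r ≡ prodFin n (λ i → p i ^ e i) * k → 2 ≤ r →
    Distinguished (suc (suc s₀)) t r ⇔
    (∀ i → (ord (p i ^ (j i + e i)) (suc (suc s₀)) ≡ ord (p i ^ e i) (suc (suc s₀)))
    ⊎ (ord (p i ^ (j i + e i)) (suc (suc s₀)) ∣ ord k (suc (suc s₀))))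
lemma3p5 s₀ t g g*d≡s∸1 n p j prime p-injective j≥1 refl e k k≥1 gs⊥k _ refl r≥2
  with t′ , ∣t∣≡dt′ , g⊥t′ ← gcd-cofactors {T = ∣ t ∣} g*d≡s∸1 = begin
  Distinguished s t r                   ∼⟨ distinguished⇔ {t = t} {d = d} g*d≡s∸1 ∣t∣≡dt′ r≥2 r⊥s ⟩
  (r * g ∣ t′ * Y)                      ≡⟨ cong (_∣ t′ * Y) r*g≡Πpʲ⁺ᵉ*k ⟩
  (prodFin n pʲ⁺ᵉ * k ∣ t′ * Y)         ∼⟨ coprime⇒*∣*⇔ (Πp^c⊥ p⊥t′ j+e) (Πp^c⊥ p⊥k j+e) k∣Y ⟩
  (prodFin n pʲ⁺ᵉ ∣ Y)                  ∼⟨ Πp^c∣s^∸1⇔ j+e (ord r s) ⟩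
  (∀ i → ord (pʲ⁺ᵉ i) s ∣ ord r s)      ∼⟨ ∀-cong (λ i → ord[p^[j+e]]∣ord-r⇔ i (j i)) ⟩
  (∀ i → ord (pʲ⁺ᵉ i) s ≡ ord (pᵉ i) s ⊎ (ord (pʲ⁺ᵉ i) s ∣ ord k s)) ∎
  where
  open Related.EquationalReasoning {k = Related.equivalence}
  s = suc (suc s₀)
  d = gcd (suc s₀) ∣ t ∣
  j+e : Fin n → ℕ
  j+e i = j i + e i
  pʲ⁺ᵉ : Fin n → ℕ
  pʲ⁺ᵉ i = p i ^ j+e i
  p∣g : ∀ i → p i ∣ g
  p∣g i = ∣-trans (m∣m^n (j≥1 i)) (∣prodFin n (λ i → p i ^ j i) i)
  p∣s∸1 : ∀ i → p i ∣ s ∸ 1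
  p∣s∸1 i = ∣-trans (p∣g i) (divides d (trans (sym g*d≡s∸1) (*-comm g d)))
  p⊥k : ∀ i → Coprime (p i) k
  p⊥k i = ∣∧coprime⇒coprime (∣m⇒∣m*n s (p∣g i)) gs⊥k
  p⊥t′ : ∀ i → Coprime (p i) t′
  p⊥t′ i = ∣∧coprime⇒coprime (p∣g i) g⊥t′
  open Components s e k prime p-injective p∣s∸1 k≥1 (Coprime.sym (∣∧coprime⇒coprime (n∣m*n g) gs⊥k)) p⊥k
  Y = s ^ ord r s ∸ 1
  k∣Y : k ∣ Y
  k∣Y = ∣-trans (n∣m*n (prodFin n pᵉ)) (Order.∣s^ord∸1 s r≥1 r⊥s)
  r*g≡Πpʲ⁺ᵉ*k : r * g ≡ prodFin n pʲ⁺ᵉ * k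
  r*g≡Πpʲ⁺ᵉ*k = trans (*-comm (prodFin n pᵉ * k) g)
    (trans (sym (*-assoc g (prodFin n pᵉ) k)) (cong (_* k) (sym (prodFin-^-+ n p j e))))
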